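{- For every $\mathsf F$-term $P$ and every $\mathsf T$-term $Q$, $\mathrm{EqFSCL}\vdash P=P\wedge x$ and $\mathrm{EqFSCL}\vdash Q=Q\vee x$, where $x$ is a variable.
   Context: Terms are over constants $\mathsf T,\mathsf F$, atoms $a\in A$, unary $\neg$ and binary $\wedge,\vee$, plus variables. $\mathsf T$-terms: $P^{\mathsf T}::=\mathsf T\mid (a\wedge P^{\mathsf T})\vee P^{\mathsf T}$; $\mathsf F$-terms: $P^{\mathsf F}::=\mathsf F\mid (a\vee P^{\mathsf F})\wedge P^{\mathsf F}$ ($a\in A$). $\mathrm{EqFSCL}\vdash s=t$ means derivability in equational logic from: (F1) $\mathsf F=\neg\mathsf T$; (F2) $x\vee y=\neg(\neg x\wedge\neg y)$; (F3) $\neg\neg x=x$; (F4) $\mathsf T\wedge x=x$; (F5) $x\vee\mathsf F=x$; (F6) $\mathsf F\wedge x=\mathsf F$; (F7) $(x\wedge y)\wedge z=x\wedge(y\wedge z)$; (F8) $\neg x\wedge\mathsf F=x\wedge\mathsf F$; (F9) $(x\wedge\mathsf F)\vee y=(x\vee\mathsf T)\wedge y$; (F10) $(x\wedge y)\vee(z\wedge\mathsf F)=(x\vee(z\wedge\mathsf F))\wedge(y\vee(z\wedge\mathsf F))$. -}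

module Defs where

open import Data.Nat using (ℕ)

data Term (A : Set) : Set where
  T F  : Term A
  atom : A → Term A
  var  : ℕ → Term A
  ¬'_  : Term A → Term A
  _∧'_ : Term A → Term A → Term A
  _∨'_ : Term A → Term A → Term A

infix  9 ¬'_
infixr 7 _∧'_
infixr 6 _∨'_

data IsTTerm {A : Set} : Term A → Set where
  tT    : IsTTerm T
  tStep : ∀ (a : A) {P Q} → IsTTerm P → IsTTerm Q → IsTTerm ((atom a ∧' P) ∨' Q)

data IsFTerm {A : Set} : Term A → Set where
  fF    : IsFTerm F
  fStep : ∀ (a : A) {P Q} → IsFTerm P → IsFTerm Q → IsFTerm ((atom a ∨' P) ∧' Q)

subst' : {A : Set} → (ℕ → Term A) → Term A → Term A
subst' σ T = T
subst' σ F = F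
subst' σ (atom a) = atom a
subst' σ (var n) = σ n
subst' σ (¬' t) = ¬' subst' σ t
subst' σ (t ∧' u) = subst' σ t ∧' subst' σ u
subst' σ (t ∨' u) = subst' σ t ∨' subst' σ u

-- The axioms F1–F10 of EqFSCL, with x = var 0, y = var 1, z = var 2.
data Axiom {A : Set} : Term A → Term A → Set where
  F1  : Axiom F (¬' T)
  F2  : Axiom (var 0 ∨' var 1) (¬' (¬' var 0 ∧' ¬' var 1))
  F3  : Axiom (¬' ¬' var 0) (var 0)
  F4  : Axiom (T ∧' var 0) (var 0)
  F5  : Axiom (var 0 ∨' F) (var 0)
  F6  : Axiom (F ∧' var 0) F
  F7  : Axiom ((var 0 ∧' var 1) ∧' var 2) (var 0 ∧' (var 1 ∧' var 2))
  F8  : Axiom (¬' var 0 ∧' F) (var 0 ∧' F)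
  F9  : Axiom ((var 0 ∧' F) ∨' var 1) ((var 0 ∨' T) ∧' var 1)
  F10 : Axiom ((var 0 ∧' var 1) ∨' (var 2 ∧' F))
              ((var 0 ∨' (var 2 ∧' F)) ∧' (var 1 ∨' (var 2 ∧' F)))

data EqFSCL⊢ {A : Set} : Term A → Term A → Set where
  ax     : ∀ {s t} → Axiom s t → EqFSCL⊢ s t
  refl'  : ∀ {s} → EqFSCL⊢ s s
  sym'   : ∀ {s t} → EqFSCL⊢ s t → EqFSCL⊢ t s
  trans' : ∀ {s t u} → EqFSCL⊢ s t → EqFSCL⊢ t u → EqFSCL⊢ s u
  sub    : ∀ (σ : ℕ → Term A) {s t} → EqFSCL⊢ s t → EqFSCL⊢ (subst' σ s) (subst' σ t)
  cong¬  : ∀ {s t} → EqFSCL⊢ s t → EqFSCL⊢ (¬' s) (¬' t)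
  cong∧  : ∀ {s s' t t'} → EqFSCL⊢ s s' → EqFSCL⊢ t t' → EqFSCL⊢ (s ∧' t) (s' ∧' t')
  cong∨  : ∀ {s s' t t'} → EqFSCL⊢ s s' → EqFSCL⊢ t t' → EqFSCL⊢ (s ∨' t) (s' ∨' t')

-- An F-term is a right-nested conjunction ending in F, and a T-term a right-nested
-- disjunction ending in T. So P ∧ x reassociates (F7) to a term whose innermost
-- conjunct is F ∧ x = F (F6), and Q ∨ x reassociates to one whose innermost disjunct
-- is T ∨ x; the latter equals T via the dual F2, F1, F6, F3, once associativity of ∨
-- has been derived from F7 by De Morgan (F2, F3).
module Submission where

open import Defs
open import Data.Nat using (ℕ; zero; suc)
open import Data.Product using (_×_; _,_)
open import Relation.Binary.Bundles using (Setoid)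
import Relation.Binary.Reasoning.Setoid as SetoidReasoning

module _ {A : Set} where

  EqFSCL-setoid : Setoid _ _
  EqFSCL-setoid = record
    { Carrier       = Term A
    ; _≈_           = EqFSCL⊢
    ; isEquivalence = record { refl = refl' ; sym = sym' ; trans = trans' }
    }

  open SetoidReasoning EqFSCL-setoid

  -- Instantiates x, y, z (var 0, var 1, var 2) of an axiom; further variables go to T.
  [_,_,_] : Term A → Term A → Term A → ℕ → Term A
  [ u , v , w ] zero                = u
  [ u , v , w ] (suc zero)          = v
  [ u , v , w ] (suc (suc zero))    = w
  [ u , v , w ] (suc (suc (suc _))) = T

  ∨-deMorgan : (u v : Term A) → EqFSCL⊢ (u ∨' v) (¬' (¬' u ∧' ¬' v))
  ∨-deMorgan u v = sub [ u , v , T ] (ax F2)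

  ¬¬-elim : (u : Term A) → EqFSCL⊢ (¬' ¬' u) u
  ¬¬-elim u = sub [ u , T , T ] (ax F3)

  F-zeroˡ-∧ : (u : Term A) → EqFSCL⊢ (F ∧' u) F
  F-zeroˡ-∧ u = sub [ u , T , T ] (ax F6)

  ∧-assoc : (u v w : Term A) → EqFSCL⊢ ((u ∧' v) ∧' w) (u ∧' (v ∧' w))
  ∧-assoc u v w = sub [ u , v , w ] (ax F7)

  ∨-assoc : (u v w : Term A) → EqFSCL⊢ ((u ∨' v) ∨' w) (u ∨' (v ∨' w))
  ∨-assoc u v w = begin
    (u ∨' v) ∨' w                      ≈⟨ ∨-deMorgan (u ∨' v) w ⟩
    ¬' (¬' (u ∨' v) ∧' ¬' w)           ≈⟨ cong¬ (cong∧ (cong¬ (∨-deMorgan u v)) refl') ⟩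
    ¬' (¬' ¬' (¬' u ∧' ¬' v) ∧' ¬' w)  ≈⟨ cong¬ (cong∧ (¬¬-elim _) refl') ⟩
    ¬' ((¬' u ∧' ¬' v) ∧' ¬' w)        ≈⟨ cong¬ (∧-assoc _ _ _) ⟩
    ¬' (¬' u ∧' (¬' v ∧' ¬' w))        ≈⟨ cong¬ (cong∧ refl' (¬¬-elim _)) ⟨
    ¬' (¬' u ∧' ¬' ¬' (¬' v ∧' ¬' w))  ≈⟨ cong¬ (cong∧ refl' (cong¬ (∨-deMorgan v w))) ⟨
    ¬' (¬' u ∧' ¬' (v ∨' w))           ≈⟨ ∨-deMorgan u (v ∨' w) ⟨
    u ∨' (v ∨' w)                      ∎

  T-zeroˡ-∨ : (u : Term A) → EqFSCL⊢ (T ∨' u) T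
  T-zeroˡ-∨ u = begin
    T ∨' u             ≈⟨ ∨-deMorgan T u ⟩
    ¬' (¬' T ∧' ¬' u)  ≈⟨ cong¬ (cong∧ (ax F1) refl') ⟨
    ¬' (F ∧' ¬' u)     ≈⟨ cong¬ (F-zeroˡ-∧ (¬' u)) ⟩
    ¬' F               ≈⟨ cong¬ (ax F1) ⟩
    ¬' ¬' T            ≈⟨ ¬¬-elim T ⟩
    T                  ∎

  FTerm-absorbs-∧ : {P : Term A} → IsFTerm P → (t : Term A) → EqFSCL⊢ P (P ∧' t)
  FTerm-absorbs-∧ fF t = sym' (F-zeroˡ-∧ t)
  FTerm-absorbs-∧ (fStep a {P} {Q} _ isF-Q) t = begin
    (atom a ∨' P) ∧' Q         ≈⟨ cong∧ refl' (FTerm-absorbs-∧ isF-Q t) ⟩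
    (atom a ∨' P) ∧' (Q ∧' t)  ≈⟨ ∧-assoc _ _ _ ⟨
    ((atom a ∨' P) ∧' Q) ∧' t  ∎

  TTerm-absorbs-∨ : {Q : Term A} → IsTTerm Q → (t : Term A) → EqFSCL⊢ Q (Q ∨' t)
  TTerm-absorbs-∨ tT t = sym' (T-zeroˡ-∨ t)
  TTerm-absorbs-∨ (tStep a {P} {Q} _ isT-Q) t = begin
    (atom a ∧' P) ∨' Q         ≈⟨ cong∨ refl' (TTerm-absorbs-∨ isT-Q t) ⟩
    (atom a ∧' P) ∨' (Q ∨' t)  ≈⟨ ∨-assoc _ _ _ ⟨
    ((atom a ∧' P) ∨' Q) ∨' t  ∎

lemmaA1 : {A : Set} (x : ℕ) (P Q : Term A) → IsFTerm P → IsTTerm Q →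
          EqFSCL⊢ P (P ∧' var x) × EqFSCL⊢ Q (Q ∨' var x)
lemmaA1 x P Q isF-P isT-Q = FTerm-absorbs-∧ isF-P (var x) , TTerm-absorbs-∨ isT-Q (var x)
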